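{- Let $\Lambda$ be a labeled polytree sequent with $w\in\mathrm{Lab}(\Lambda)$, and let $\mathsf P$ be a finite set of simplified primitive tense axioms. For any two $w$-partitions $\Lambda_1,\Lambda_2$ and $\Lambda_1',\Lambda_2'$ of $\Lambda$, the display sequents $\mathfrak D^w_1(\Lambda_1)\vdash\mathfrak D^w_2(\Lambda_2)$ and $\mathfrak D^w_1(\Lambda_1')\vdash\mathfrak D^w_2(\Lambda_2')$ are each derivable from the other in $\mathsf{DK_tP}$.
   Context: Formulae: $A ::= p \mid \top \mid \bot \mid \neg A \mid (A\lor A)\mid (A\land A)\mid (A\to A)\mid \mathsf{G}A\mid \mathsf{F}A\mid \mathsf{H}A\mid \mathsf{P}A$. A simplified primitive tense axiom is $A\to(B_1\lor\dots\lor B_m)$ with $A,B_j$ built from atoms and $\top$ by $\land,\mathsf F,\mathsf P$, each atom at most once in $A$. Structures $X ::= A \mid I \mid {\ast}X \mid {\bullet}X \mid (X\circ X)$; display sequent $X\vdash Y$. $\mathsf{DK_tP}$ is the display calculus consisting of: initial $p\vdash p$, $I\vdash\top$, $\bot\vdash I$; logical rules (premise(s)/conclusion): $I\vdash Y/\top\vdash Y$; $X\vdash I/X\vdash\bot$; ${\ast}A\vdash Y/\neg A\vdash Y$; $X\vdash{\ast}A/X\vdash\neg A$; $X\circ A\vdash B/X\vdash A\to B$; $X\vdash A,\ B\vdash Y/A\to B\vdash{\ast}X\circ Y$; $X\vdash A\circ B/X\vdash A\lor B$; $A\vdash Y,\ B\vdash Y/A\lor B\vdash Y$; $A\circ B\vdash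 Y/A\land B\vdash Y$; $X\vdash A,\ X\vdash B/X\vdash A\land B$; $A\vdash Y/\mathsf GA\vdash{\bullet}Y$; ${\bullet}X\vdash A/X\vdash\mathsf GA$; $A\vdash{\ast}{\bullet}{\ast}Y/\mathsf FA\vdash Y$; $X\vdash A/{\ast}{\bullet}{\ast}X\vdash\mathsf FA$; ${\ast}{\bullet}{\ast}X\vdash A/X\vdash\mathsf HA$; $A\vdash Y/\mathsf HA\vdash{\ast}{\bullet}{\ast}Y$; $A\vdash{\bullet}Y/\mathsf PA\vdash Y$; $X\vdash A/{\bullet}X\vdash\mathsf PA$; bidirectional display rules $X\circ Y\vdash Z\Leftrightarrow X\vdash Z\circ{\ast}Y$; $X\circ Y\vdash Z\Leftrightarrow Y\vdash{\ast}X\circ Z$; $X\vdash Y\circ Z\Leftrightarrow X\circ{\ast}Z\vdash Y$; $X\vdash Y\circ Z\Leftrightarrow{\ast}Y\circ X\vdash Z$; ${\ast}X\vdash Y\Leftrightarrow{\ast}Y\vdash X$; $X\vdash{\ast}Y\Leftrightarrow Y\vdash{\ast}X$; ${\ast}{\ast}X\vdash Y\Leftrightarrow X\vdash Y$; $X\vdash{\ast}{\ast}Y\Leftrightarrow X\vdash Y$; $X\vdash{\bullet}Y\Leftrightarrow{\bullet}X\vdash Y$; structural rules $X\vdash Y\Leftrightarrow I\circ X\vdash Y$; $X\vdash Y\Leftrightarrow X\vdash I\circ Y$; $I\vdash Y\Leftrightarrow{\ast}I\vdash Y$; $X\vdash I\Leftrightarrow X\vdash{\ast}I$; $X\circ(Y\circ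 Z)\vdash W\Leftrightarrow(X\circ Y)\circ Z\vdash W$; $X\vdash Y\circ(Z\circ W)\Leftrightarrow X\vdash(Y\circ Z)\circ W$; $X\vdash Y/Z\circ X\vdash Y$; $X\vdash Y/X\vdash Y\circ Z$; $X\circ Y\vdash Z/Y\circ X\vdash Z$; $X\vdash Y\circ Z/X\vdash Z\circ Y$; $X\circ X\vdash Y/X\vdash Y$; $X\vdash Y\circ Y/X\vdash Y$; $I\vdash Y/{\bullet}I\vdash Y$; $X\vdash I/X\vdash{\bullet}I$; $X\vdash A,\ A\vdash Y/X\vdash Y$; and for each axiom of $\mathsf P$ the rule with premises $\psi(B_j)\vdash X$ and conclusion $\psi(A)\vdash X$, where $\psi(\top)=I$, $\psi(p)=X_p$, $\psi(A\land B)=\psi(A)\circ\psi(B)$, $\psi(\mathsf FA)={\ast}{\bullet}{\ast}\psi(A)$, $\psi(\mathsf PA)={\bullet}\psi(A)$. $D$ is derivable from $D'$ if there is a finite tree of rule instances with root $D$ whose leaves are $D'$ or instances of initial rules. Labeled sequents $\mathcal R,\Gamma\Rightarrow\Delta$ ($\mathcal R$ finite set of relational atoms $Rwu$, $\Gamma,\Delta$ finite multisets of labeled formulae $w:A$); $\mathrm{Lab}(\cdot)$ labels; composition $\otimes$ = union of relational atoms and multiset unions of antecedents and succedents. Labeled polytree sequent: (1) if no relational atoms, all formulae share one label; (2) otherwise every formula label occurs in a relational atom; (3) graph (nodes labels, edges $(w,u)$ for $Rwu$) connected and free of directed and undirected cycles. A $w$-partition of $\Lambda$ is a pair of labeled polytree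 sequents $\Lambda_1,\Lambda_2$ with $\Lambda=\Lambda_1\otimes\Lambda_2$ and $\mathrm{Lab}(\Lambda_1)\cap\mathrm{Lab}(\Lambda_2)=\{w\}$. For $Rwu$ or $Ruw$ in a labeled polytree sequent $\Lambda'$, $\Lambda'|^w_u$ consists of the relational atoms (other than the one between $w$ and $u$) and labeled formulae of $\Lambda'$ lying in the component of $u$ of the graph with the edge between $w$ and $u$ removed. $\Gamma\restriction w$ is $A_1\circ\dots\circ A_n$ for the formulae $w:A_i$ in $\Gamma$, and $I$ if there are none. For $\Lambda'=\mathcal R',\Gamma'\Rightarrow\Delta'$: if $\mathcal R'=\emptyset$, $\mathfrak D^w_1(\Lambda')=(\Gamma'\restriction w)\circ{\ast}(\Delta'\restriction w)$ and $\mathfrak D^w_2(\Lambda')={\ast}(\Gamma'\restriction w)\circ(\Delta'\restriction w)$; otherwise, with $Rwu_1,\dots,Rwu_n$ all atoms $Rwy$ and $Rv_1w,\dots,Rv_kw$ all atoms $Ryw$ of $\Lambda'$, $\mathfrak D^w_1(\Lambda')=(\Gamma'\restriction w)\circ{\ast}(\Delta'\restriction w)\circ{\ast}{\bullet}{\ast}\mathfrak D^{u_1}_1(\Lambda'|^w_{u_1})\circ\dots\circ{\ast}{\bullet}{\ast}\mathfrak D^{u_n}_1(\Lambda'|^w_{u_n})\circ{\bullet}\mathfrak D^{v_1}_1(\Lambda'|^w_{v_1})\circ\dots\circ{\bullet}\mathfrak D^{v_k}_1(\Lambda'|^w_{v_k})$ and $\mathfrak D^w_2(\Lambda')={\ast}(\Gamma'\restriction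 w)\circ(\Delta'\restriction w)\circ{\bullet}\mathfrak D^{u_1}_2(\Lambda'|^w_{u_1})\circ\dots\circ{\bullet}\mathfrak D^{u_n}_2(\Lambda'|^w_{u_n})\circ{\ast}{\bullet}{\ast}\mathfrak D^{v_1}_2(\Lambda'|^w_{v_1})\circ\dots\circ{\ast}{\bullet}{\ast}\mathfrak D^{v_k}_2(\Lambda'|^w_{v_k})$. -}

module Defs where

open import Data.Nat using (ℕ; zero; suc; _≟_)
open import Data.List using (List; []; _∷_; _++_; map; filter; length; concatMap; lookup)
open import Data.List.NonEmpty using (List⁺; toList)
open import Data.List.Membership.Propositional using (_∈_)
open import Data.List.Membership.DecPropositional _≟_ using () renaming (_∈?_ to _∈ℕ?_)
open import Data.List.Relation.Unary.Any using (Any)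
open import Data.List.Relation.Unary.All using (All)
open import Data.List.Relation.Unary.AllPairs using (AllPairs)
open import Data.List.Relation.Binary.Permutation.Propositional using (_↭_)
open import Data.Product using (Σ; ∃; _×_; _,_; proj₁; proj₂)
open import Data.Product.Properties using (≡-dec)
open import Data.Sum using (_⊎_)
open import Data.Fin using (Fin)
open import Relation.Binary.PropositionalEquality using (_≡_; _≢_)
open import Relation.Nullary using (¬_; ¬?)
open import Relation.Nullary.Decidable using (_×-dec_)

data Fm : Set where
  var  : ℕ → Fm
  ⊤'   : Fm
  ⊥'   : Fm
  ¬'_  : Fm → Fm
  _∨'_ : Fm → Fm → Fm
  _∧'_ : Fm → Fm → Fm
  _⇒_  : Fm → Fm → Fm
  G    : Fm → Fm
  F    : Fm → Fm
  H    : Fm → Fm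
  P    : Fm → Fm

infixr 5 _∘_
data St : Set where
  ⌜_⌝ : Fm → St
  I   : St
  ∗_  : St → St
  •_  : St → St
  _∘_ : St → St → St

infix 3 _⊢_
record Seq : Set where
  constructor _⊢_
  field
    lhs : St
    rhs : St

-- Simplified primitive tense axioms  A → (B₁ ∨ … ∨ Bₘ)
-- A, Bⱼ built from atoms and ⊤ by ∧, F, P.

data PF : Set where
  pvar : ℕ → PF
  ptop : PF
  _p∧_ : PF → PF → PF
  pF   : PF → PF
  pP   : PF → PF

atomsOf : PF → List ℕ
atomsOf (pvar p) = p ∷ []
atomsOf ptop = []
atomsOf (A p∧ B) = atomsOf A ++ atomsOf B
atomsOf (pF A) = atomsOf A
atomsOf (pP A) = atomsOf A

record Axiom : Set where
  constructor mkAxiom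
  field
    ante   : PF
    conss  : List⁺ PF
    linear : AllPairs _≢_ (atomsOf ante)

open Axiom public

ψ : (ℕ → St) → PF → St
ψ σ (pvar p) = σ p
ψ σ ptop = I
ψ σ (A p∧ B) = ψ σ A ∘ ψ σ B
ψ σ (pF A) = ∗ • ∗ ψ σ A
ψ σ (pP A) = • ψ σ A

-- The calculus DKtP: Der 𝒫 h s  means  s is derivable from h in DKtP

data Der (𝒫 : List Axiom) (h : Seq) : Seq → Set where
  hyp  : Der 𝒫 h h
  idp  : ∀ {p} → Der 𝒫 h (⌜ var p ⌝ ⊢ ⌜ var p ⌝)
  id⊤  : Der 𝒫 h (I ⊢ ⌜ ⊤' ⌝)
  id⊥  : Der 𝒫 h (⌜ ⊥' ⌝ ⊢ I)
  ⊤L : ∀ {Y} → Der 𝒫 h (I ⊢ Y) → Der 𝒫 h (⌜ ⊤' ⌝ ⊢ Y)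
  ⊥R : ∀ {X} → Der 𝒫 h (X ⊢ I) → Der 𝒫 h (X ⊢ ⌜ ⊥' ⌝)
  ¬L : ∀ {A Y} → Der 𝒫 h (∗ ⌜ A ⌝ ⊢ Y) → Der 𝒫 h (⌜ ¬' A ⌝ ⊢ Y)
  ¬R : ∀ {A X} → Der 𝒫 h (X ⊢ ∗ ⌜ A ⌝) → Der 𝒫 h (X ⊢ ⌜ ¬' A ⌝)
  ⇒R : ∀ {A B X} → Der 𝒫 h (X ∘ ⌜ A ⌝ ⊢ ⌜ B ⌝) → Der 𝒫 h (X ⊢ ⌜ A ⇒ B ⌝)
  ⇒L : ∀ {A B X Y} → Der 𝒫 h (X ⊢ ⌜ A ⌝) → Der 𝒫 h (⌜ B ⌝ ⊢ Y)
       → Der 𝒫 h (⌜ A ⇒ B ⌝ ⊢ ∗ X ∘ Y)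
  ∨R : ∀ {A B X} → Der 𝒫 h (X ⊢ ⌜ A ⌝ ∘ ⌜ B ⌝) → Der 𝒫 h (X ⊢ ⌜ A ∨' B ⌝)
  ∨L : ∀ {A B Y} → Der 𝒫 h (⌜ A ⌝ ⊢ Y) → Der 𝒫 h (⌜ B ⌝ ⊢ Y)
       → Der 𝒫 h (⌜ A ∨' B ⌝ ⊢ Y)
  ∧L : ∀ {A B Y} → Der 𝒫 h (⌜ A ⌝ ∘ ⌜ B ⌝ ⊢ Y) → Der 𝒫 h (⌜ A ∧' B ⌝ ⊢ Y)
  ∧R : ∀ {A B X} → Der 𝒫 h (X ⊢ ⌜ A ⌝) → Der 𝒫 h (X ⊢ ⌜ B ⌝)
       → Der 𝒫 h (X ⊢ ⌜ A ∧' B ⌝)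
  GL : ∀ {A Y} → Der 𝒫 h (⌜ A ⌝ ⊢ Y) → Der 𝒫 h (⌜ G A ⌝ ⊢ • Y)
  GR : ∀ {A X} → Der 𝒫 h (• X ⊢ ⌜ A ⌝) → Der 𝒫 h (X ⊢ ⌜ G A ⌝)
  FL : ∀ {A Y} → Der 𝒫 h (⌜ A ⌝ ⊢ ∗ • ∗ Y) → Der 𝒫 h (⌜ F A ⌝ ⊢ Y)
  FR : ∀ {A X} → Der 𝒫 h (X ⊢ ⌜ A ⌝) → Der 𝒫 h (∗ • ∗ X ⊢ ⌜ F A ⌝)
  HR : ∀ {A X} → Der 𝒫 h (∗ • ∗ X ⊢ ⌜ A ⌝) → Der 𝒫 h (X ⊢ ⌜ H A ⌝)
  HL : ∀ {A Y} → Der 𝒫 h (⌜ A ⌝ ⊢ Y) → Der 𝒫 h (⌜ H A ⌝ ⊢ ∗ • ∗ Y)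
  PL : ∀ {A Y} → Der 𝒫 h (⌜ A ⌝ ⊢ • Y) → Der 𝒫 h (⌜ P A ⌝ ⊢ Y)
  PR : ∀ {A X} → Der 𝒫 h (X ⊢ ⌜ A ⌝) → Der 𝒫 h (• X ⊢ ⌜ P A ⌝)
  d1  : ∀ {X Y Z} → Der 𝒫 h (X ∘ Y ⊢ Z) → Der 𝒫 h (X ⊢ Z ∘ ∗ Y)
  d1⁻ : ∀ {X Y Z} → Der 𝒫 h (X ⊢ Z ∘ ∗ Y) → Der 𝒫 h (X ∘ Y ⊢ Z)
  d2  : ∀ {X Y Z} → Der 𝒫 h (X ∘ Y ⊢ Z) → Der 𝒫 h (Y ⊢ ∗ X ∘ Z)
  d2⁻ : ∀ {X Y Z} → Der 𝒫 h (Y ⊢ ∗ X ∘ Z) → Der 𝒫 h (X ∘ Y ⊢ Z)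
  d3  : ∀ {X Y Z} → Der 𝒫 h (X ⊢ Y ∘ Z) → Der 𝒫 h (X ∘ ∗ Z ⊢ Y)
  d3⁻ : ∀ {X Y Z} → Der 𝒫 h (X ∘ ∗ Z ⊢ Y) → Der 𝒫 h (X ⊢ Y ∘ Z)
  d4  : ∀ {X Y Z} → Der 𝒫 h (X ⊢ Y ∘ Z) → Der 𝒫 h (∗ Y ∘ X ⊢ Z)
  d4⁻ : ∀ {X Y Z} → Der 𝒫 h (∗ Y ∘ X ⊢ Z) → Der 𝒫 h (X ⊢ Y ∘ Z)
  d5  : ∀ {X Y} → Der 𝒫 h (∗ X ⊢ Y) → Der 𝒫 h (∗ Y ⊢ X)
  d5⁻ : ∀ {X Y} → Der 𝒫 h (∗ Y ⊢ X) → Der 𝒫 h (∗ X ⊢ Y)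
  d6  : ∀ {X Y} → Der 𝒫 h (X ⊢ ∗ Y) → Der 𝒫 h (Y ⊢ ∗ X)
  d6⁻ : ∀ {X Y} → Der 𝒫 h (Y ⊢ ∗ X) → Der 𝒫 h (X ⊢ ∗ Y)
  d7  : ∀ {X Y} → Der 𝒫 h (∗ ∗ X ⊢ Y) → Der 𝒫 h (X ⊢ Y)
  d7⁻ : ∀ {X Y} → Der 𝒫 h (X ⊢ Y) → Der 𝒫 h (∗ ∗ X ⊢ Y)
  d8  : ∀ {X Y} → Der 𝒫 h (X ⊢ ∗ ∗ Y) → Der 𝒫 h (X ⊢ Y)
  d8⁻ : ∀ {X Y} → Der 𝒫 h (X ⊢ Y) → Der 𝒫 h (X ⊢ ∗ ∗ Y)
  d9  : ∀ {X Y} → Der 𝒫 h (X ⊢ • Y) → Der 𝒫 h (• X ⊢ Y)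
  d9⁻ : ∀ {X Y} → Der 𝒫 h (• X ⊢ Y) → Der 𝒫 h (X ⊢ • Y)
  IL    : ∀ {X Y} → Der 𝒫 h (X ⊢ Y) → Der 𝒫 h (I ∘ X ⊢ Y)
  IL⁻   : ∀ {X Y} → Der 𝒫 h (I ∘ X ⊢ Y) → Der 𝒫 h (X ⊢ Y)
  IR    : ∀ {X Y} → Der 𝒫 h (X ⊢ Y) → Der 𝒫 h (X ⊢ I ∘ Y)
  IR⁻   : ∀ {X Y} → Der 𝒫 h (X ⊢ I ∘ Y) → Der 𝒫 h (X ⊢ Y)
  I∗L   : ∀ {Y} → Der 𝒫 h (I ⊢ Y) → Der 𝒫 h (∗ I ⊢ Y)
  I∗L⁻  : ∀ {Y} → Der 𝒫 h (∗ I ⊢ Y) → Der 𝒫 h (I ⊢ Y)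
  I∗R   : ∀ {X} → Der 𝒫 h (X ⊢ I) → Der 𝒫 h (X ⊢ ∗ I)
  I∗R⁻  : ∀ {X} → Der 𝒫 h (X ⊢ ∗ I) → Der 𝒫 h (X ⊢ I)
  asL   : ∀ {X Y Z W} → Der 𝒫 h (X ∘ (Y ∘ Z) ⊢ W) → Der 𝒫 h ((X ∘ Y) ∘ Z ⊢ W)
  asL⁻  : ∀ {X Y Z W} → Der 𝒫 h ((X ∘ Y) ∘ Z ⊢ W) → Der 𝒫 h (X ∘ (Y ∘ Z) ⊢ W)
  asR   : ∀ {X Y Z W} → Der 𝒫 h (X ⊢ Y ∘ (Z ∘ W)) → Der 𝒫 h (X ⊢ (Y ∘ Z) ∘ W)
  asR⁻  : ∀ {X Y Z W} → Der 𝒫 h (X ⊢ (Y ∘ Z) ∘ W) → Der 𝒫 h (X ⊢ Y ∘ (Z ∘ W))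
  wL    : ∀ {X Y Z} → Der 𝒫 h (X ⊢ Y) → Der 𝒫 h (Z ∘ X ⊢ Y)
  wR    : ∀ {X Y Z} → Der 𝒫 h (X ⊢ Y) → Der 𝒫 h (X ⊢ Y ∘ Z)
  exL   : ∀ {X Y Z} → Der 𝒫 h (X ∘ Y ⊢ Z) → Der 𝒫 h (Y ∘ X ⊢ Z)
  exR   : ∀ {X Y Z} → Der 𝒫 h (X ⊢ Y ∘ Z) → Der 𝒫 h (X ⊢ Z ∘ Y)
  ctrL  : ∀ {X Y} → Der 𝒫 h (X ∘ X ⊢ Y) → Der 𝒫 h (X ⊢ Y)
  ctrR  : ∀ {X Y} → Der 𝒫 h (X ⊢ Y ∘ Y) → Der 𝒫 h (X ⊢ Y)
  I•L   : ∀ {Y} → Der 𝒫 h (I ⊢ Y) → Der 𝒫 h (• I ⊢ Y)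
  I•R   : ∀ {X} → Der 𝒫 h (X ⊢ I) → Der 𝒫 h (X ⊢ • I)
  cut   : ∀ {A X Y} → Der 𝒫 h (X ⊢ ⌜ A ⌝) → Der 𝒫 h (⌜ A ⌝ ⊢ Y) → Der 𝒫 h (X ⊢ Y)
  axr   : ∀ {X} (α : Axiom) → α ∈ 𝒫 → (σ : ℕ → St)
          → (∀ B → B ∈ toList (conss α) → Der 𝒫 h (ψ σ B ⊢ X))
          → Der 𝒫 h (ψ σ (ante α) ⊢ X)

-- Labeled sequents  𝓡, Γ ⇒ Δ   (𝓡 a finite set of relational atoms
-- Rwu, encoded as the pair (w , u); Γ, Δ multisets of labeled formulae)

record LSeq : Set where
  constructor ⟨_,_,_⟩
  field
    rel  : List (ℕ × ℕ)
    antL : List (ℕ × Fm)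
    sucL : List (ℕ × Fm)

open LSeq public

_occurs-in_ : ℕ → ℕ × ℕ → Set
x occurs-in e = proj₁ e ≡ x ⊎ proj₂ e ≡ x

_∈Lab_ : ℕ → LSeq → Set
x ∈Lab Λ = Any (x occurs-in_) (rel Λ)
         ⊎ Any (λ lf → proj₁ lf ≡ x) (antL Λ)
         ⊎ Any (λ lf → proj₁ lf ≡ x) (sucL Λ)

UStep : (R : List (ℕ × ℕ)) → ℕ → Fin (length R) → ℕ → Set
UStep R x i y = lookup R i ≡ (x , y) ⊎ lookup R i ≡ (y , x)

data UWalk (R : List (ℕ × ℕ)) : ℕ → ℕ → List (Fin (length R)) → Set where
  here  : ∀ {x} → UWalk R x x []
  there : ∀ {x y z i is} → UStep R x i y → UWalk R y z is → UWalk R x z (i ∷ is)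

data DWalk (R : List (ℕ × ℕ)) : ℕ → ℕ → List (Fin (length R)) → Set where
  here  : ∀ {x} → DWalk R x x []
  there : ∀ {x y z i is} → lookup R i ≡ (x , y) → DWalk R y z is → DWalk R x z (i ∷ is)

UCycle : List (ℕ × ℕ) → Set
UCycle R = Σ ℕ λ x → Σ (List (Fin (length R))) λ is →
           UWalk R x x is × is ≢ [] × AllPairs _≢_ is

DCycle : List (ℕ × ℕ) → Set
DCycle R = Σ ℕ λ x → Σ (List (Fin (length R))) λ is →
           DWalk R x x is × is ≢ [] × AllPairs _≢_ is

Connected : LSeq → Set
Connected Λ = ∀ x y → x ∈Lab Λ → y ∈Lab Λ → ∃ λ is → UWalk (rel Λ) x y is

record Polytree (Λ : LSeq) : Set where
  field
    cond1 : rel Λ ≡ [] → ∃ λ w → All (λ lf → proj₁ lf ≡ w) (antL Λ)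
                                × All (λ lf → proj₁ lf ≡ w) (sucL Λ)
    cond2 : rel Λ ≢ [] → All (λ lf → Any (proj₁ lf occurs-in_) (rel Λ)) (antL Λ)
                       × All (λ lf → Any (proj₁ lf occurs-in_) (rel Λ)) (sucL Λ)
    connected : Connected Λ
    no-ucycle : ¬ UCycle (rel Λ)
    no-dcycle : ¬ DCycle (rel Λ)

-- Λ = Λ₁ ⊗ Λ₂  (set union of relational atoms, multiset union of formulae)
record _≋_⊗_ (Λ Λ₁ Λ₂ : LSeq) : Set where
  field
    rel-to   : ∀ e → e ∈ rel Λ → e ∈ rel Λ₁ ⊎ e ∈ rel Λ₂
    rel-from : ∀ e → e ∈ rel Λ₁ ⊎ e ∈ rel Λ₂ → e ∈ rel Λ
    ant-eq   : antL Λ ↭ antL Λ₁ ++ antL Λ₂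
    suc-eq   : sucL Λ ↭ sucL Λ₁ ++ sucL Λ₂

record Partition (w : ℕ) (Λ Λ₁ Λ₂ : LSeq) : Set where
  field
    poly₁ : Polytree Λ₁
    poly₂ : Polytree Λ₂
    split : Λ ≋ Λ₁ ⊗ Λ₂
    inter-to   : ∀ x → x ∈Lab Λ₁ → x ∈Lab Λ₂ → x ≡ w
    inter-from₁ : w ∈Lab Λ₁
    inter-from₂ : w ∈Lab Λ₂

conc : List St → St
conc [] = I
conc (x ∷ []) = x
conc (x ∷ y ∷ xs) = x ∘ conc (y ∷ xs)

_↾_ : List (ℕ × Fm) → ℕ → St
Γ ↾ w = conc (map (λ lf → ⌜ proj₂ lf ⌝) (filter (λ lf → proj₁ lf ≟ w) Γ))

outN : ℕ → List (ℕ × ℕ) → List ℕ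
outN w R = map proj₂ (filter (λ e → proj₁ e ≟ w) R)

inN : ℕ → List (ℕ × ℕ) → List ℕ
inN w R = map proj₁ (filter (λ e → proj₂ e ≟ w) R)

reach : ℕ → List (ℕ × ℕ) → List ℕ → List ℕ
reach zero E S = S
reach (suc n) E S = reach n E (S ++ concatMap (λ x → outN x E ++ inN x E) S)

_≟ₑ_ = ≡-dec _≟_ _≟_

restrict : ℕ → ℕ → LSeq → LSeq
restrict w u ⟨ R , Γ , Δ ⟩ =
  ⟨ filter (λ e → proj₁ e ∈ℕ? C) E
  , filter (λ lf → proj₁ lf ∈ℕ? C) Γ
  , filter (λ lf → proj₁ lf ∈ℕ? C) Δ ⟩
  where
  E = filter (λ e → ¬? (e ≟ₑ (w , u)) ×-dec ¬? (e ≟ₑ (u , w))) R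
  C = reach (length E) E (u ∷ [])

-- fuel-indexed versions (fuel = number of relational atoms + 1 suffices)
D₁ : ℕ → ℕ → LSeq → St
D₁ zero w Λ = I
D₁ (suc f) w ⟨ [] , Γ , Δ ⟩ = (Γ ↾ w) ∘ ∗ (Δ ↾ w)
D₁ (suc f) w ⟨ e ∷ R , Γ , Δ ⟩ =
  conc ((Γ ↾ w) ∷ ∗ (Δ ↾ w)
        ∷ (map (λ u → ∗ • ∗ D₁ f u (restrict w u ⟨ e ∷ R , Γ , Δ ⟩)) (outN w (e ∷ R))
           ++ map (λ v → • D₁ f v (restrict w v ⟨ e ∷ R , Γ , Δ ⟩)) (inN w (e ∷ R))))

D₂ : ℕ → ℕ → LSeq → St
D₂ zero w Λ = I
D₂ (suc f) w ⟨ [] , Γ , Δ ⟩ = ∗ (Γ ↾ w) ∘ (Δ ↾ w)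
D₂ (suc f) w ⟨ e ∷ R , Γ , Δ ⟩ =
  conc (∗ (Γ ↾ w) ∷ (Δ ↾ w)
        ∷ (map (λ u → • D₂ f u (restrict w u ⟨ e ∷ R , Γ , Δ ⟩)) (outN w (e ∷ R))
           ++ map (λ v → ∗ • ∗ D₂ f v (restrict w v ⟨ e ∷ R , Γ , Δ ⟩)) (inN w (e ∷ R))))

𝔇₁ : ℕ → LSeq → St
𝔇₁ w Λ = D₁ (suc (length (rel Λ))) w Λ

𝔇₂ : ℕ → LSeq → St
𝔇₂ w Λ = D₂ (suc (length (rel Λ))) w Λ

-- Both sequents are interderivable with I ⊢ 𝔇₂ w Λ. The display and structural
-- rules make ∘ a commutative monoid with unit I and ∗ an involution distributing
-- over ∘, up to interchangeability of structures; so X ⊢ Y is interderivable with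
-- I ⊢ ∗ X ∘ Y, and ∗ 𝔇₁ is interchangeable with 𝔇₂. It remains to merge
-- 𝔇₂ w Λ₁ ∘ 𝔇₂ w Λ₂ into 𝔇₂ w Λ: the formulae and neighbours of w are split between
-- the two parts, and since the parts share only w and Λ₁ is acyclic, the branch of
-- Λ₁ at a neighbour u of w is the branch of Λ at u up to reordering, to which 𝔇₂ is
-- insensitive.
module Submission where

open import Defs
open import Algebra.Definitions using (Associative; Commutative; LeftIdentity; RightIdentity)
open import Algebra.Structures using (IsCommutativeMonoid)
open import Algebra.Bundles using (CommutativeSemigroup)
import Algebra.Properties.CommutativeSemigroup as CommutativeSemigroupProperties
open import Data.Nat using (ℕ; zero; suc; _≤_; _<_; z≤n; s≤s; _≟_)
open import Data.Nat.Properties using (≤-<-trans; <-≤-trans)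
open import Data.Fin using (Fin; zero; suc)
open import Data.Fin.Properties using (suc-injective)
open import Data.List using (List; []; _∷_; _++_; map; foldr; filter; length; lookup; [_])
open import Data.List.Properties
  using (map-∘; map-++; filter-≐; filter-++; filter-none; filter-notAll; length-filter; ++-identityʳ)
open import Data.List.Membership.Propositional using (_∈_; _∉_; find; lose)
open import Data.List.Membership.Propositional.Properties
  using (∈-map⁺; ∈-map⁻; ∈-filter⁺; ∈-filter⁻; ∈-++⁺ˡ; ∈-++⁺ʳ; ∈-++⁻; ∈-concatMap⁺; ∈-concatMap⁻
        ; ∈-∃++)
open import Data.List.Membership.Propositional.Properties.WithK using (unique∧set⇒bag)
open import Data.List.Membership.DecPropositional _≟_ using () renaming (_∈?_ to _∈ℕ?_)
open import Data.List.Relation.Unary.Any using (Any; here; there; index)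
open import Data.List.Relation.Unary.Any.Properties using (lookup-index)
import Data.List.Relation.Unary.All as All
open import Data.List.Relation.Unary.All using ([]; _∷_)
open import Data.List.Relation.Unary.All.Properties using (¬Any⇒All¬)
open import Data.List.Relation.Unary.AllPairs using ([]; _∷_)
open import Data.List.Relation.Unary.Unique.Propositional using (Unique)
import Data.List.Relation.Unary.Unique.Propositional.Properties as Unique
open import Data.List.Relation.Binary.Permutation.Propositional
  using (_↭_; ↭-sym; ↭-trans; ↭-reflexive; ↭⇒↭ₛ′; module PermutationReasoning)
open import Data.List.Relation.Binary.Permutation.Propositional.Properties
  using (map⁺; filter-↭; ∈-resp-↭; ++-comm; shift; ↭-length)
import Data.List.Relation.Binary.Permutation.Setoid.Properties as SetoidPermutation
open import Data.List.Relation.Binary.BagAndSetEquality using (∼bag⇒↭)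
open import Data.Product using (Σ; ∃; _×_; _,_; proj₁; proj₂)
open import Data.Sum using (_⊎_; inj₁; inj₂; [_,_]′)
import Data.Sum as Sum
open import Data.Empty using (⊥-elim)
open import Function using (_∘′_; _⇔_; mk⇔; Equivalence)
open import Function.Properties.Equivalence using () renaming (sym to ⇔-sym)
open import Relation.Binary.Bundles using (Setoid)
open import Relation.Binary.Structures using (IsEquivalence)
open import Relation.Binary.Construct.Closure.ReflexiveTransitive as Star using (Star; ε; _◅_; _◅◅_)
open import Relation.Binary.PropositionalEquality
  using (_≡_; _≢_; refl; sym; trans; subst; cong; cong₂; module ≡-Reasoning)
import Relation.Binary.Reasoning.Setoid as SetoidReasoning
open import Relation.Nullary using (¬_; ¬?; Dec; yes; no)
open import Relation.Nullary.Decidable using (_×-dec_)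

module DisplayEquivalence (𝒫 : List Axiom) where

  infix 4 _⟺_ _≈_

  record _⟺_ (s t : Seq) : Set where
    constructor mk⟺
    field
      to   : ∀ {h} → Der 𝒫 h s → Der 𝒫 h t
      from : ∀ {h} → Der 𝒫 h t → Der 𝒫 h s
  open _⟺_ public

  ⟺-isEquivalence : IsEquivalence _⟺_
  ⟺-isEquivalence = record
    { refl  = mk⟺ (λ d → d) (λ d → d)
    ; sym   = λ e → mk⟺ (from e) (to e)
    ; trans = λ e f → mk⟺ (λ d → to f (to e d)) (λ d → from e (from f d))
    }

  ⟺-setoid : Setoid _ _
  ⟺-setoid = record { isEquivalence = ⟺-isEquivalence }

  open IsEquivalence ⟺-isEquivalence public
    using () renaming (refl to ⟺-refl; sym to ⟺-sym; trans to ⟺-trans)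

  d1⟺ : ∀ {X Y Z} → (X ∘ Y ⊢ Z) ⟺ (X ⊢ Z ∘ ∗ Y)
  d1⟺ = mk⟺ d1 d1⁻

  d2⟺ : ∀ {X Y Z} → (X ∘ Y ⊢ Z) ⟺ (Y ⊢ ∗ X ∘ Z)
  d2⟺ = mk⟺ d2 d2⁻

  d3⟺ : ∀ {X Y Z} → (X ⊢ Y ∘ Z) ⟺ (X ∘ ∗ Z ⊢ Y)
  d3⟺ = mk⟺ d3 d3⁻

  d4⟺ : ∀ {X Y Z} → (X ⊢ Y ∘ Z) ⟺ (∗ Y ∘ X ⊢ Z)
  d4⟺ = mk⟺ d4 d4⁻

  d5⟺ : ∀ {X Y} → (∗ X ⊢ Y) ⟺ (∗ Y ⊢ X)
  d5⟺ = mk⟺ d5 d5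

  d6⟺ : ∀ {X Y} → (X ⊢ ∗ Y) ⟺ (Y ⊢ ∗ X)
  d6⟺ = mk⟺ d6 d6

  d9⟺ : ∀ {X Y} → (X ⊢ • Y) ⟺ (• X ⊢ Y)
  d9⟺ = mk⟺ d9 d9⁻

  contraposition⟺ : ∀ {X Y} → (X ⊢ Y) ⟺ (∗ Y ⊢ ∗ X)
  contraposition⟺ = mk⟺ (d5 ∘′ d7⁻) (d7 ∘′ d5)

  ⊢⟺I⊢∗∘ : ∀ {X Y} → (X ⊢ Y) ⟺ (I ⊢ ∗ X ∘ Y)
  ⊢⟺I⊢∗∘ = mk⟺ (exR ∘′ d1 ∘′ IL) (IL⁻ ∘′ d1⁻ ∘′ exR)

  record _≈_ (X Y : St) : Set where
    constructor mk≈
    field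
      antecedent : ∀ {Z} → (X ⊢ Z) ⟺ (Y ⊢ Z)
      succedent  : ∀ {Z} → (Z ⊢ X) ⟺ (Z ⊢ Y)
  open _≈_ public

  ≈-isEquivalence : IsEquivalence _≈_
  ≈-isEquivalence = record
    { refl  = mk≈ ⟺-refl ⟺-refl
    ; sym   = λ e → mk≈ (⟺-sym (antecedent e)) (⟺-sym (succedent e))
    ; trans = λ e f → mk≈ (⟺-trans (antecedent e) (antecedent f))
                          (⟺-trans (succedent e) (succedent f))
    }

  ≈-setoid : Setoid _ _
  ≈-setoid = record { isEquivalence = ≈-isEquivalence }

  open IsEquivalence ≈-isEquivalence public
    using () renaming (refl to ≈-refl; sym to ≈-sym; trans to ≈-trans; reflexive to ≈-reflexive)

  -- By the display property a structure can always be isolated on one side,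
  -- so interchangeability is a congruence.
  ∗-cong : ∀ {X Y} → X ≈ Y → ∗ X ≈ ∗ Y
  ∗-cong e = mk≈ (⟺-trans d5⟺ (⟺-trans (succedent e) d5⟺))
                 (⟺-trans d6⟺ (⟺-trans (antecedent e) d6⟺))

  •-cong : ∀ {X Y} → X ≈ Y → • X ≈ • Y
  •-cong e = mk≈ (⟺-trans (⟺-sym d9⟺) (⟺-trans (antecedent e) d9⟺))
                 (⟺-trans d9⟺ (⟺-trans (succedent e) (⟺-sym d9⟺)))

  ∘-congʳ : ∀ {X Y W} → X ≈ Y → X ∘ W ≈ Y ∘ W
  ∘-congʳ e = mk≈ (⟺-trans d1⟺ (⟺-trans (antecedent e) (⟺-sym d1⟺)))
                  (⟺-trans d3⟺ (⟺-trans (succedent e) (⟺-sym d3⟺)))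

  ∘-congˡ : ∀ {X Y W} → X ≈ Y → W ∘ X ≈ W ∘ Y
  ∘-congˡ e = mk≈ (⟺-trans d2⟺ (⟺-trans (antecedent e) (⟺-sym d2⟺)))
                  (⟺-trans d4⟺ (⟺-trans (succedent e) (⟺-sym d4⟺)))

  ∘-cong : ∀ {X X' Y Y'} → X ≈ X' → Y ≈ Y' → X ∘ Y ≈ X' ∘ Y'
  ∘-cong e f = ≈-trans (∘-congʳ e) (∘-congˡ f)

  ∘-assoc : Associative _≈_ _∘_
  ∘-assoc _ _ _ = mk≈ (mk⟺ asL⁻ asL) (mk⟺ asR⁻ asR)

  ∘-comm : Commutative _≈_ _∘_
  ∘-comm _ _ = mk≈ (mk⟺ exL exL) (mk⟺ exR exR)

  ∘-identityˡ : LeftIdentity _≈_ I _∘_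
  ∘-identityˡ _ = mk≈ (mk⟺ IL⁻ IL) (mk⟺ IR⁻ IR)

  ∘-identityʳ : RightIdentity _≈_ I _∘_
  ∘-identityʳ X = ≈-trans (∘-comm X I) (∘-identityˡ X)

  ∘-isCommutativeMonoid : IsCommutativeMonoid _≈_ _∘_ I
  ∘-isCommutativeMonoid = record
    { isMonoid = record
      { isSemigroup = record
        { isMagma = record { isEquivalence = ≈-isEquivalence ; ∙-cong = ∘-cong }
        ; assoc = ∘-assoc }
      ; identity = ∘-identityˡ , ∘-identityʳ }
    ; comm = ∘-comm
    }

  ∘-commutativeSemigroup : CommutativeSemigroup _ _
  ∘-commutativeSemigroup = record
    { isCommutativeSemigroup = IsCommutativeMonoid.isCommutativeSemigroup ∘-isCommutativeMonoid }

  open CommutativeSemigroupProperties ∘-commutativeSemigroup public using (interchange)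

  ∗-involutive : ∀ {X} → ∗ ∗ X ≈ X
  ∗-involutive = mk≈ (mk⟺ d7 d7⁻) (mk⟺ d8 d8⁻)

  ∗-I : ∗ I ≈ I
  ∗-I = mk≈ (mk⟺ I∗L⁻ I∗L) (mk⟺ I∗R⁻ I∗R)

  ∗-distrib-∘ : ∀ {X Y} → ∗ (X ∘ Y) ≈ ∗ X ∘ ∗ Y
  ∗-distrib-∘ {X} {Y} = mk≈ (onLeft X Y) onRight
    where
    open SetoidReasoning ⟺-setoid
    onLeft : ∀ X Y {Z} → (∗ (X ∘ Y) ⊢ Z) ⟺ (∗ X ∘ ∗ Y ⊢ Z)
    onLeft X Y {Z} = begin
      (∗ (X ∘ Y) ⊢ Z)        ≈⟨ d5⟺ ⟩
      (∗ Z ⊢ X ∘ Y)          ≈⟨ d3⟺ ⟩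
      (∗ Z ∘ ∗ Y ⊢ X)        ≈⟨ antecedent (∘-comm (∗ Z) (∗ Y)) ⟩
      (∗ Y ∘ ∗ Z ⊢ X)        ≈⟨ d1⟺ ⟩
      (∗ Y ⊢ X ∘ ∗ ∗ Z)      ≈⟨ succedent (∘-cong (≈-sym ∗-involutive) ∗-involutive) ⟩
      (∗ Y ⊢ ∗ ∗ X ∘ Z)      ≈⟨ d2⟺ ⟨
      (∗ X ∘ ∗ Y ⊢ Z)        ∎
    onRight : ∀ {Z} → (Z ⊢ ∗ (X ∘ Y)) ⟺ (Z ⊢ ∗ X ∘ ∗ Y)
    onRight {Z} = begin
      (Z ⊢ ∗ (X ∘ Y))            ≈⟨ contraposition⟺ ⟩
      (∗ ∗ (X ∘ Y) ⊢ ∗ Z)        ≈⟨ antecedent ∗-involutive ⟩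
      (X ∘ Y ⊢ ∗ Z)              ≈⟨ antecedent (∘-cong ∗-involutive ∗-involutive) ⟨
      (∗ ∗ X ∘ ∗ ∗ Y ⊢ ∗ Z)      ≈⟨ onLeft (∗ X) (∗ Y) ⟨
      (∗ (∗ X ∘ ∗ Y) ⊢ ∗ Z)      ≈⟨ contraposition⟺ ⟨
      (Z ⊢ ∗ X ∘ ∗ Y)            ∎

  conc-∷ : ∀ x xs → conc (x ∷ xs) ≈ x ∘ conc xs
  conc-∷ x []      = ≈-sym (∘-identityʳ x)
  conc-∷ x (_ ∷ _) = ≈-refl

  conc-++ : ∀ xs ys → conc (xs ++ ys) ≈ conc xs ∘ conc ys
  conc-++ [] ys = ≈-sym (∘-identityˡ (conc ys))
  conc-++ (x ∷ xs) ys = begin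
    conc (x ∷ xs ++ ys)        ≈⟨ conc-∷ x (xs ++ ys) ⟩
    x ∘ conc (xs ++ ys)        ≈⟨ ∘-congˡ (conc-++ xs ys) ⟩
    x ∘ conc xs ∘ conc ys      ≈⟨ ∘-assoc x (conc xs) (conc ys) ⟨
    (x ∘ conc xs) ∘ conc ys    ≈⟨ ∘-congʳ (conc-∷ x xs) ⟨
    conc (x ∷ xs) ∘ conc ys    ∎
    where open SetoidReasoning ≈-setoid

  conc-∷-∷-++ : ∀ a b xs ys → conc (a ∷ b ∷ xs ++ ys) ≈ a ∘ b ∘ conc xs ∘ conc ys
  conc-∷-∷-++ a b xs ys = ∘-congˡ (≈-trans (conc-∷ b (xs ++ ys)) (∘-congˡ (conc-++ xs ys)))

  conc≈foldr : ∀ xs → conc xs ≈ foldr _∘_ I xs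
  conc≈foldr []       = ≈-refl
  conc≈foldr (x ∷ xs) = ≈-trans (conc-∷ x xs) (∘-congˡ (conc≈foldr xs))

  conc-resp-↭ : ∀ {xs ys} → xs ↭ ys → conc xs ≈ conc ys
  conc-resp-↭ {xs} {ys} p = begin
    conc xs          ≈⟨ conc≈foldr xs ⟩
    foldr _∘_ I xs   ≈⟨ SetoidPermutation.foldr-commMonoid ≈-setoid ∘-isCommutativeMonoid
                          (↭⇒↭ₛ′ ≈-isEquivalence p) ⟩
    foldr _∘_ I ys   ≈⟨ conc≈foldr ys ⟨
    conc ys          ∎
    where open SetoidReasoning ≈-setoid

  conc-map-cong : ∀ {A : Set} {g g' : A → St} xs → (∀ {x} → x ∈ xs → g x ≈ g' x)
    → conc (map g xs) ≈ conc (map g' xs)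
  conc-map-cong [] _ = ≈-refl
  conc-map-cong (x ∷ xs) g≈g' =
    ≈-trans (conc-∷ _ (map _ xs))
      (≈-trans (∘-cong (g≈g' (here refl)) (conc-map-cong xs (g≈g' ∘′ there)))
        (≈-sym (conc-∷ _ (map _ xs))))

  conc-map-↭ : ∀ {A : Set} {g g' : A → St} {xs ys} → xs ↭ ys → (∀ {x} → x ∈ xs → g x ≈ g' x)
    → conc (map g xs) ≈ conc (map g' ys)
  conc-map-↭ {xs = xs} p g≈g' = ≈-trans (conc-map-cong xs g≈g') (conc-resp-↭ (map⁺ _ p))

  ∗-conc : ∀ xs → ∗ conc xs ≈ conc (map ∗_ xs)
  ∗-conc []           = ∗-I
  ∗-conc (x ∷ [])     = ≈-refl
  ∗-conc (x ∷ y ∷ xs) = ≈-trans ∗-distrib-∘ (∘-congˡ (∗-conc (y ∷ xs)))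

  ∗-conc-map : ∀ {A : Set} (g : A → St) xs → ∗ conc (map g xs) ≈ conc (map (∗_ ∘′ g) xs)
  ∗-conc-map g xs = ≈-trans (∗-conc (map g xs)) (≈-reflexive (cong conc (sym (map-∘ xs))))

  conc-map-split : ∀ {A : Set} {g g₁ g₂ : A → St} {xs xs₁ xs₂} → xs ↭ xs₁ ++ xs₂
    → (∀ {x} → x ∈ xs₁ → g₁ x ≈ g x) → (∀ {x} → x ∈ xs₂ → g₂ x ≈ g x)
    → conc (map g₁ xs₁) ∘ conc (map g₂ xs₂) ≈ conc (map g xs)
  conc-map-split {g = g} {xs = xs} {xs₁} {xs₂} p g₁≈g g₂≈g = begin
    conc (map _ xs₁) ∘ conc (map _ xs₂)   ≈⟨ ∘-cong (conc-map-cong xs₁ g₁≈g) (conc-map-cong xs₂ g₂≈g) ⟩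
    conc (map g xs₁) ∘ conc (map g xs₂)   ≈⟨ conc-++ (map g xs₁) (map g xs₂) ⟨
    conc (map g xs₁ ++ map g xs₂)         ≡⟨ cong conc (map-++ g xs₁ xs₂) ⟨
    conc (map g (xs₁ ++ xs₂))             ≈⟨ conc-resp-↭ (map⁺ g (↭-sym p)) ⟩
    conc (map g xs)                       ∎
    where open SetoidReasoning ≈-setoid

Edges : Set
Edges = List (ℕ × ℕ)

Adjacent : Edges → ℕ → ℕ → Set
Adjacent E x y = (x , y) ∈ E ⊎ (y , x) ∈ E

Walk : Edges → ℕ → ℕ → Set
Walk E = Star (Adjacent E)

module _ {E : Edges} where

  edgeOf : ∀ {x y} → Adjacent E x y → ℕ × ℕ
  edgeOf {x} {y} (inj₁ _) = x , y
  edgeOf {x} {y} (inj₂ _) = y , x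

  edgeOf∈ : ∀ {x y} (s : Adjacent E x y) → edgeOf s ∈ E
  edgeOf∈ (inj₁ m) = m
  edgeOf∈ (inj₂ m) = m

  vertices : ∀ {x y} → Walk E x y → List ℕ
  vertices {x} ε       = [ x ]
  vertices {x} (_ ◅ p) = x ∷ vertices p

  edges : ∀ {x y} → Walk E x y → List (ℕ × ℕ)
  edges ε       = []
  edges (s ◅ p) = edgeOf s ∷ edges p

  start∈vertices : ∀ {x y} (p : Walk E x y) → x ∈ vertices p
  start∈vertices ε       = here refl
  start∈vertices (_ ◅ _) = here refl

  edges⊆ : ∀ {x y} (p : Walk E x y) {e} → e ∈ edges p → e ∈ E
  edges⊆ (s ◅ p) (here refl) = edgeOf∈ s
  edges⊆ (s ◅ p) (there m)   = edges⊆ p m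

  endpoints∈vertices : ∀ {x y} (p : Walk E x y) {a b} → (a , b) ∈ edges p
    → a ∈ vertices p × b ∈ vertices p
  endpoints∈vertices (inj₁ _ ◅ p) (here refl) = here refl , there (start∈vertices p)
  endpoints∈vertices (inj₂ _ ◅ p) (here refl) = there (start∈vertices p) , here refl
  endpoints∈vertices (_ ◅ p) (there m) =
    let a∈ , b∈ = endpoints∈vertices p m in there a∈ , there b∈

  unique-edges : ∀ {x y} (p : Walk E x y) → Unique (vertices p) → Unique (edges p)
  unique-edges ε       _          = []
  unique-edges {x} (s ◅ p) (x∉ ∷ u) = All.tabulate (fresh s) ∷ unique-edges p u
    where
    fresh : ∀ {y} (s : Adjacent E x y) {e} → e ∈ edges p → edgeOf s ≢ e
    fresh (inj₁ _) m refl = All.lookup x∉ (proj₁ (endpoints∈vertices p m)) refl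
    fresh (inj₂ _) m refl = All.lookup x∉ (proj₂ (endpoints∈vertices p m)) refl

  suffix : ∀ {a x y} (p : Walk E a y) → Unique (vertices p) → x ∈ vertices p
    → Σ (Walk E x y) (Unique ∘′ vertices)
  suffix ε       u       (here refl) = ε , u
  suffix (s ◅ p) u       (here refl) = s ◅ p , u
  suffix (s ◅ p) (_ ∷ u) (there m)   = suffix p u m

  -- Loop erasure: if x recurs on the simplified rest, continue from that occurrence.
  simplify : ∀ {x y} → Walk E x y → Σ (Walk E x y) (Unique ∘′ vertices)
  simplify ε = ε , [] ∷ []
  simplify {x} (s ◅ p) with simplify p
  ... | q , u with x ∈ℕ? vertices q
  ...   | yes m = suffix q u m
  ...   | no x∉ = s ◅ q , ¬Any⇒All¬ (vertices q) x∉ ∷ u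

unique⊆⇒length≤ : ∀ {A : Set} {xs ys : List A} → Unique xs → (∀ {a} → a ∈ xs → a ∈ ys)
  → length xs ≤ length ys
unique⊆⇒length≤ {xs = []}     _          _ = z≤n
unique⊆⇒length≤ {xs = x ∷ xs} (x∉ ∷ u) xs⊆ys with ∈-∃++ (xs⊆ys (here refl))
... | ys₁ , ys₂ , refl =
  subst (suc (length xs) ≤_) (sym (↭-length (shift x ys₁ ys₂)))
    (s≤s (unique⊆⇒length≤ u xs⊆ys₁++ys₂))
  where
  xs⊆ys₁++ys₂ : ∀ {a} → a ∈ xs → a ∈ ys₁ ++ ys₂
  xs⊆ys₁++ys₂ {a} a∈ with ∈-++⁻ ys₁ (xs⊆ys (there a∈))
  ... | inj₁ m         = ∈-++⁺ˡ m
  ... | inj₂ (here refl) = ⊥-elim (All.lookup x∉ a∈ refl)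
  ... | inj₂ (there m) = ∈-++⁺ʳ ys₁ m

short-walk : ∀ {E x y} → Walk E x y → Σ (Walk E x y) λ p → length (edges p) ≤ length E
short-walk p with simplify p
... | q , u = q , unique⊆⇒length≤ (unique-edges q u) (edges⊆ q)

neighbours : Edges → ℕ → List ℕ
neighbours E x = outN x E ++ inN x E

outN-sound : ∀ {R x y} → y ∈ outN x R → (x , y) ∈ R
outN-sound {x = x} m with ∈-map⁻ proj₂ m
... | _ , i , refl with ∈-filter⁻ (λ e → proj₁ e ≟ x) i
...   | j , refl = j

inN-sound : ∀ {R x y} → y ∈ inN x R → (y , x) ∈ R
inN-sound {x = x} m with ∈-map⁻ proj₁ m
... | _ , i , refl with ∈-filter⁻ (λ e → proj₂ e ≟ x) i
...   | j , refl = j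

outN-↭ : ∀ x {R R'} → R ↭ R' → outN x R ↭ outN x R'
outN-↭ x p = map⁺ proj₂ (filter-↭ _ p)

inN-↭ : ∀ x {R R'} → R ↭ R' → inN x R ↭ inN x R'
inN-↭ x p = map⁺ proj₁ (filter-↭ _ p)

outN-split : ∀ x {R} R₁ R₂ → R ↭ R₁ ++ R₂ → outN x R ↭ outN x R₁ ++ outN x R₂
outN-split x R₁ R₂ p = ↭-trans (outN-↭ x p) (↭-reflexive (begin
  outN x (R₁ ++ R₂)                            ≡⟨ cong (map proj₂) (filter-++ at-x R₁ R₂) ⟩
  map proj₂ (filter at-x R₁ ++ filter at-x R₂) ≡⟨ map-++ proj₂ (filter at-x R₁) (filter at-x R₂) ⟩
  outN x R₁ ++ outN x R₂                       ∎))
  where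
  open ≡-Reasoning
  at-x : (e : ℕ × ℕ) → Dec (proj₁ e ≡ x)
  at-x e = proj₁ e ≟ x

inN-split : ∀ x {R} R₁ R₂ → R ↭ R₁ ++ R₂ → inN x R ↭ inN x R₁ ++ inN x R₂
inN-split x R₁ R₂ p = ↭-trans (inN-↭ x p) (↭-reflexive (begin
  inN x (R₁ ++ R₂)                             ≡⟨ cong (map proj₁) (filter-++ at-x R₁ R₂) ⟩
  map proj₁ (filter at-x R₁ ++ filter at-x R₂) ≡⟨ map-++ proj₁ (filter at-x R₁) (filter at-x R₂) ⟩
  inN x R₁ ++ inN x R₂                         ∎))
  where
  open ≡-Reasoning
  at-x : (e : ℕ × ℕ) → Dec (proj₂ e ≡ x)
  at-x e = proj₂ e ≟ x

neighbours-complete : ∀ {E x y} → Adjacent E x y → y ∈ neighbours E x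
neighbours-complete {E} {x} (inj₁ m) = ∈-++⁺ˡ (∈-map⁺ proj₂ (∈-filter⁺ (λ e → proj₁ e ≟ x) m refl))
neighbours-complete {E} {x} (inj₂ m) =
  ∈-++⁺ʳ (outN x E) (∈-map⁺ proj₁ (∈-filter⁺ (λ e → proj₂ e ≟ x) m refl))

neighbours-sound : ∀ {E x y} → y ∈ neighbours E x → Adjacent E x y
neighbours-sound {E} {x} m with ∈-++⁻ (outN x E) m
... | inj₁ m' = inj₁ (outN-sound m')
... | inj₂ m' = inj₂ (inN-sound m')

reach-⊇ : ∀ n E S {s} → s ∈ S → s ∈ reach n E S
reach-⊇ zero    E S m = m
reach-⊇ (suc n) E S m = reach-⊇ n E _ (∈-++⁺ˡ m)

reach-sound : ∀ n E S {y} → y ∈ reach n E S → ∃ λ s → s ∈ S × Walk E s y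
reach-sound zero    E S {y} m = y , m , ε
reach-sound (suc n) E S m with reach-sound n E _ m
... | s , s∈ , p with ∈-++⁻ S s∈
...   | inj₁ i = s , i , p
...   | inj₂ i with find (∈-concatMap⁻ (neighbours E) {xs = S} i)
...     | x , x∈ , s∈nb = x , x∈ , neighbours-sound s∈nb ◅ p

reach-complete : ∀ n E S {s y} (p : Walk E s y) → length (edges p) ≤ n → s ∈ S → y ∈ reach n E S
reach-complete n       E S ε       _         m = reach-⊇ n E S m
reach-complete (suc n) E S (a ◅ p) (s≤s le) m =
  reach-complete n E _ p le (∈-++⁺ʳ S (∈-concatMap⁺ (neighbours E) (lose m (neighbours-complete a))))

reach⇒Walk : ∀ {E u y} → y ∈ reach (length E) E [ u ] → Walk E u y
reach⇒Walk {E} {u} m with reach-sound (length E) E [ u ] m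
... | _ , here refl , p = p

-- length E rounds suffice: a walk simplifies to one with pairwise distinct edges.
Walk⇒reach : ∀ {E u y} → Walk E u y → y ∈ reach (length E) E [ u ]
Walk⇒reach {E} {u} p with short-walk p
... | q , le = reach-complete (length E) E [ u ] q le (here refl)

walk-⊆ : ∀ {E E'} → (∀ {e} → e ∈ E → e ∈ E') → ∀ {x y} → Walk E x y → Walk E' x y
walk-⊆ E⊆E' = Star.map (Sum.map E⊆E' E⊆E')

walk-closed : ∀ {E} (V : ℕ → Set) → (∀ {a b} → (a , b) ∈ E → V a × V b)
  → ∀ {x y} → Walk E x y → V x → V y
walk-closed V closed ε            vx = vx
walk-closed V closed (inj₁ m ◅ p) vx = walk-closed V closed p (proj₂ (closed m))
walk-closed V closed (inj₂ m ◅ p) vx = walk-closed V closed p (proj₁ (closed m))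

confine : ∀ {E E₁ E₂} (V : ℕ → Set) {u} → (∀ {e} → e ∈ E → e ∈ E₁ ⊎ e ∈ E₂)
  → (∀ {a b} → (a , b) ∈ E₂ → V a × V b) → (∀ {x} → Walk E₁ u x → ¬ V x)
  → ∀ {y z} → Walk E₁ u y → Walk E y z → Walk E₁ u z
confine V split closed₂ avoid acc ε = acc
confine {E₁ = E₁} {E₂} V split closed₂ avoid acc (s ◅ p) with split (edgeOf∈ s)
... | inj₁ m = confine V split closed₂ avoid (acc ◅◅ (step s m ◅ ε)) p
  where
  step : ∀ {y y'} (s : Adjacent _ y y') → edgeOf s ∈ E₁ → Adjacent E₁ y y'
  step (inj₁ _) m = inj₁ m
  step (inj₂ _) m = inj₂ m
... | inj₂ m = ⊥-elim (avoid acc (source∈V s m))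
  where
  source∈V : ∀ {y y'} (s : Adjacent _ y y') → edgeOf s ∈ E₂ → V y
  source∈V (inj₁ _) m = proj₁ (closed₂ m)
  source∈V (inj₂ _) m = proj₂ (closed₂ m)

infix 4 _≃_
record _≃_ (Λ Λ' : LSeq) : Set where
  field
    rel-↭  : rel Λ ↭ rel Λ'
    antL-↭ : antL Λ ↭ antL Λ'
    sucL-↭ : sucL Λ ↭ sucL Λ'
open _≃_ public

cutEdge : ℕ → ℕ → Edges → Edges
cutEdge w u = filter (λ e → ¬? (e ≟ₑ (w , u)) ×-dec ¬? (e ≟ₑ (u , w)))

branch : ℕ → ℕ → Edges → List ℕ
branch w u R = reach (length (cutEdge w u R)) (cutEdge w u R) [ u ]

onBranch : {B : Set} → ℕ → ℕ → Edges → List (ℕ × B) → List (ℕ × B)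
onBranch w u R = filter (λ a → proj₁ a ∈ℕ? branch w u R)

∈-cutEdge⁻ : ∀ w u R {e} → e ∈ cutEdge w u R → e ∈ R × e ≢ (w , u) × e ≢ (u , w)
∈-cutEdge⁻ w u R = ∈-filter⁻ (λ e → ¬? (e ≟ₑ (w , u)) ×-dec ¬? (e ≟ₑ (u , w))) {xs = R}

restrict-unfold : ∀ w u Λ → restrict w u Λ
  ≡ ⟨ onBranch w u (rel Λ) (cutEdge w u (rel Λ))
    , onBranch w u (rel Λ) (antL Λ)
    , onBranch w u (rel Λ) (sucL Λ) ⟩
restrict-unfold w u ⟨ R , Γ , Δ ⟩ = refl

onBranch-cong : ∀ {B : Set} w u R R' → (∀ {y} → Walk (cutEdge w u R) u y ⇔ Walk (cutEdge w u R') u y)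
  → (xs : List (ℕ × B)) → onBranch w u R xs ≡ onBranch w u R' xs
onBranch-cong w u R R' walks⇔ = filter-≐ _ _
  ( (λ m → Walk⇒reach (Equivalence.to walks⇔ (reach⇒Walk m)))
  , (λ m → Walk⇒reach (Equivalence.from walks⇔ (reach⇒Walk m))) )

walk-cutEdge-↭ : ∀ w u {R R'} → R ↭ R' → ∀ {y} → Walk (cutEdge w u R) u y → Walk (cutEdge w u R') u y
walk-cutEdge-↭ w u p = walk-⊆ (∈-resp-↭ (filter-↭ _ p))

restrict-resp-≃ : ∀ w u {Λ Λ'} → Λ ≃ Λ' → restrict w u Λ ≃ restrict w u Λ'
restrict-resp-≃ w u {Λ} {Λ'} Λ≃Λ' rewrite restrict-unfold w u Λ | restrict-unfold w u Λ' = record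
  { rel-↭  = keep (filter-↭ _ (rel-↭ Λ≃Λ'))
  ; antL-↭ = keep (antL-↭ Λ≃Λ')
  ; sucL-↭ = keep (sucL-↭ Λ≃Λ')
  }
  where
  same-walks : ∀ {y} → Walk (cutEdge w u (rel Λ)) u y ⇔ Walk (cutEdge w u (rel Λ')) u y
  same-walks = mk⇔ (walk-cutEdge-↭ w u (rel-↭ Λ≃Λ')) (walk-cutEdge-↭ w u (↭-sym (rel-↭ Λ≃Λ')))

  keep : ∀ {B : Set} {xs ys : List (ℕ × B)} → xs ↭ ys → onBranch w u (rel Λ) xs ↭ onBranch w u (rel Λ') ys
  keep {xs = xs} p = ↭-trans (↭-reflexive (onBranch-cong w u (rel Λ) (rel Λ') same-walks xs)) (filter-↭ _ p)

restrict-shrinks : ∀ w u Λ → Adjacent (rel Λ) w u → length (rel (restrict w u Λ)) < length (rel Λ)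
restrict-shrinks w u Λ adj rewrite restrict-unfold w u Λ =
  ≤-<-trans (length-filter _ (cutEdge w u (rel Λ))) (filter-notAll _ (rel Λ) (removed adj))
  where
  removed : Adjacent (rel Λ) w u → Any (λ e → ¬ (e ≢ (w , u) × e ≢ (u , w))) (rel Λ)
  removed (inj₁ m) = lose m (λ ne → proj₁ ne refl)
  removed (inj₂ m) = lose m (λ ne → proj₂ ne refl)

edge-labels : ∀ {Λ a b} → (a , b) ∈ rel Λ → a ∈Lab Λ × b ∈Lab Λ
edge-labels m = inj₁ (lose m (inj₁ refl)) , inj₁ (lose m (inj₂ refl))

lookup-injective⇒Unique : ∀ {A : Set} (xs : List A) → (∀ i j → i ≢ j → lookup xs i ≢ lookup xs j)
  → Unique xs
lookup-injective⇒Unique []       _   = []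
lookup-injective⇒Unique (x ∷ xs) inj =
  All.tabulate (λ m x≡y → inj zero (suc (index m)) (λ ()) (trans x≡y (lookup-index m)))
  ∷ lookup-injective⇒Unique xs (λ i j i≢j → inj (suc i) (suc j) (i≢j ∘′ suc-injective))

-- A repeated atom, or a loop, is already a cycle.
acyclic⇒Unique : ∀ R → ¬ UCycle R → Unique R
acyclic⇒Unique R acyclic = lookup-injective⇒Unique R λ i j i≢j eq →
  acyclic ( _ , i ∷ j ∷ [] , there (inj₁ refl) (there (inj₂ (sym eq)) here)
          , (λ ()) , (i≢j ∷ []) ∷ [] ∷ [])

acyclic⇒irreflexive : ∀ R {x} → ¬ UCycle R → (x , x) ∉ R
acyclic⇒irreflexive R acyclic m =
  acyclic (_ , index m ∷ [] , there (inj₁ (sym (lookup-index m))) here , (λ ()) , ([] ∷ []))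

module _ {E R : Edges} (E⊆R : ∀ {e} → e ∈ E → e ∈ R) where

  step-index : ∀ {x y} (s : Adjacent E x y) → Σ (Fin (length R)) λ i → UStep R x i y × lookup R i ≡ edgeOf s
  step-index (inj₁ m) = index (E⊆R m) , inj₁ (sym (lookup-index (E⊆R m))) , sym (lookup-index (E⊆R m))
  step-index (inj₂ m) = index (E⊆R m) , inj₂ (sym (lookup-index (E⊆R m))) , sym (lookup-index (E⊆R m))

  toUWalk : ∀ {x y} (p : Walk E x y)
    → Σ (List (Fin (length R))) λ is → UWalk R x y is × map (lookup R) is ≡ edges p
  toUWalk ε = [] , here , refl
  toUWalk (s ◅ p) with step-index s | toUWalk p
  ... | i , st , li | is , wk , eq = i ∷ is , there st wk , cong₂ _∷_ li eq

-- A simple walk from u back to w, closed up by the removed edge, would be a cycle.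
cutEdge-disconnects : ∀ {R w u} → ¬ UCycle R → Adjacent R w u → ¬ Walk (cutEdge w u R) u w
cutEdge-disconnects {R} {w} {u} acyclic adj p with simplify p
... | q , uq with toUWalk (proj₁ ∘′ ∈-cutEdge⁻ w u R) q | step-index (λ m → m) adj
... | is , wk , eq | i₀ , st₀ , _ =
  acyclic (w , i₀ ∷ is , there st₀ wk , (λ ()) , All.tabulate i₀∉is ∷ unique-is)
  where
  unique-is : Unique is
  unique-is = Unique.map⁻ (subst Unique (sym eq) (unique-edges q uq))

  i₀∉is : ∀ {j} → j ∈ is → i₀ ≢ j
  i₀∉is {j} j∈ refl
    with _ , ≢wu , ≢uw ← ∈-cutEdge⁻ w u R (edges⊆ q (subst (lookup R j ∈_) eq (∈-map⁺ (lookup R) j∈)))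
    = [ ≢wu , ≢uw ]′ st₀

Partition-swap : ∀ {w Λ Λ₁ Λ₂} → Partition w Λ Λ₁ Λ₂ → Partition w Λ Λ₂ Λ₁
Partition-swap {Λ₁ = Λ₁} {Λ₂} part = record
  { poly₁ = poly₂
  ; poly₂ = poly₁
  ; split = record
    { rel-to   = λ e m → Sum.swap (rel-to e m)
    ; rel-from = λ e m → rel-from e (Sum.swap m)
    ; ant-eq   = ↭-trans ant-eq (++-comm (antL Λ₁) (antL Λ₂))
    ; suc-eq   = ↭-trans suc-eq (++-comm (sucL Λ₁) (sucL Λ₂))
    }
  ; inter-to    = λ x l₂ l₁ → inter-to x l₁ l₂
  ; inter-from₁ = inter-from₂
  ; inter-from₂ = inter-from₁
  }
  where
  open Partition part
  open _≋_⊗_ split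

module _ {w Λ Λ₁ Λ₂} (polyΛ : Polytree Λ) (part : Partition w Λ Λ₁ Λ₂) where
  open Partition part
  open _≋_⊗_ split

  private
    acyclic₁ : ¬ UCycle (rel Λ₁)
    acyclic₁ = Polytree.no-ucycle poly₁

  -- An atom common to both parts would have both endpoints equal to w.
  partition-rel-↭ : rel Λ ↭ rel Λ₁ ++ rel Λ₂
  partition-rel-↭ = ∼bag⇒↭ (unique∧set⇒bag
    (acyclic⇒Unique (rel Λ) (Polytree.no-ucycle polyΛ))
    (Unique.++⁺ (acyclic⇒Unique (rel Λ₁) acyclic₁)
                (acyclic⇒Unique (rel Λ₂) (Polytree.no-ucycle poly₂)) disjoint)
    (mk⇔ (λ m → [ ∈-++⁺ˡ , ∈-++⁺ʳ (rel Λ₁) ]′ (rel-to _ m))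
         (λ m → rel-from _ (∈-++⁻ (rel Λ₁) m))))
    where
    disjoint : ∀ {e} → ¬ (e ∈ rel Λ₁ × e ∈ rel Λ₂)
    disjoint {a , b} (m₁ , m₂)
      with inter-to a (proj₁ (edge-labels m₁)) (proj₁ (edge-labels m₂))
         | inter-to b (proj₂ (edge-labels m₁)) (proj₂ (edge-labels m₂))
    ... | refl | refl = acyclic⇒irreflexive (rel Λ₁) acyclic₁ m₁

  module _ {u} (adj : Adjacent (rel Λ₁) w u) where
    private
      E E₁ E₂ : Edges
      E  = cutEdge w u (rel Λ)
      E₁ = cutEdge w u (rel Λ₁)
      E₂ = cutEdge w u (rel Λ₂)

      E↭E₁++E₂ : E ↭ E₁ ++ E₂
      E↭E₁++E₂ = ↭-trans (filter-↭ _ partition-rel-↭) (↭-reflexive (filter-++ _ (rel Λ₁) (rel Λ₂)))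

      u∈Λ₁ : u ∈Lab Λ₁
      u∈Λ₁ = [ proj₂ ∘′ edge-labels , proj₁ ∘′ edge-labels ]′ adj

      reached-in-Λ₁ : ∀ {x} → Walk E₁ u x → x ∈Lab Λ₁
      reached-in-Λ₁ p =
        walk-closed (_∈Lab Λ₁) (edge-labels ∘′ proj₁ ∘′ ∈-cutEdge⁻ w u (rel Λ₁)) p u∈Λ₁

      avoids-Λ₂ : ∀ {x} → Walk E₁ u x → ¬ x ∈Lab Λ₂
      avoids-Λ₂ p x∈Λ₂ with inter-to _ (reached-in-Λ₁ p) x∈Λ₂
      ... | refl = cutEdge-disconnects acyclic₁ adj p

      -- A walk leaving Λ₁ would pass through w, closing a cycle in Λ₁.
      branch-walks : ∀ {y} → Walk E u y ⇔ Walk E₁ u y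
      branch-walks = mk⇔
        (confine (_∈Lab Λ₂) (∈-++⁻ E₁ ∘′ ∈-resp-↭ E↭E₁++E₂)
          (edge-labels ∘′ proj₁ ∘′ ∈-cutEdge⁻ w u (rel Λ₂)) avoids-Λ₂ ε)
        (walk-⊆ (∈-resp-↭ (↭-sym E↭E₁++E₂) ∘′ ∈-++⁺ˡ))

      onBranch-split : ∀ {B : Set} {xs xs₁ xs₂ : List (ℕ × B)} → xs ↭ xs₁ ++ xs₂
        → (∀ {a} → a ∈ xs₂ → proj₁ a ∈Lab Λ₂)
        → onBranch w u (rel Λ₁) xs₁ ↭ onBranch w u (rel Λ) xs
      onBranch-split {xs = xs} {xs₁} {xs₂} p in-Λ₂ = begin
        onBranch w u (rel Λ₁) xs₁
          ≡⟨ onBranch-cong w u (rel Λ₁) (rel Λ) (⇔-sym branch-walks) xs₁ ⟩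
        onBranch w u (rel Λ) xs₁
          ≡⟨ ++-identityʳ _ ⟨
        onBranch w u (rel Λ) xs₁ ++ []
          ≡⟨ cong (_ ++_) (filter-none _ (All.tabulate off-branch)) ⟨
        onBranch w u (rel Λ) xs₁ ++ onBranch w u (rel Λ) xs₂
          ≡⟨ filter-++ _ xs₁ xs₂ ⟨
        onBranch w u (rel Λ) (xs₁ ++ xs₂)
          ↭⟨ filter-↭ _ (↭-sym p) ⟩
        onBranch w u (rel Λ) xs ∎
        where
        open PermutationReasoning
        off-branch : ∀ {a} → a ∈ xs₂ → proj₁ a ∉ branch w u (rel Λ)
        off-branch a∈ m = avoids-Λ₂ (Equivalence.to branch-walks (reach⇒Walk m)) (in-Λ₂ a∈)

    restrict-partition : restrict w u Λ₁ ≃ restrict w u Λ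
    restrict-partition rewrite restrict-unfold w u Λ₁ | restrict-unfold w u Λ = record
      { rel-↭  = onBranch-split E↭E₁++E₂ (proj₁ ∘′ edge-labels ∘′ proj₁ ∘′ ∈-cutEdge⁻ w u (rel Λ₂))
      ; antL-↭ = onBranch-split ant-eq (λ m → inj₂ (inj₁ (lose m refl)))
      ; sucL-↭ = onBranch-split suc-eq (λ m → inj₂ (inj₂ (lose m refl)))
      }

future₁ past₁ future₂ past₂ : ℕ → ℕ → LSeq → List St
future₁ f w Λ = map (λ u → ∗ • ∗ D₁ f u (restrict w u Λ)) (outN w (rel Λ))
past₁   f w Λ = map (λ v → • D₁ f v (restrict w v Λ)) (inN w (rel Λ))
future₂ f w Λ = map (λ u → • D₂ f u (restrict w u Λ)) (outN w (rel Λ))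
past₂   f w Λ = map (λ v → ∗ • ∗ D₂ f v (restrict w v Λ)) (inN w (rel Λ))

module Translations (𝒫 : List Axiom) where
  open DisplayEquivalence 𝒫
  open SetoidReasoning ≈-setoid

  D₁-unfold : ∀ f w Λ → D₁ (suc f) w Λ
    ≈ (antL Λ ↾ w) ∘ ∗ (sucL Λ ↾ w) ∘ conc (future₁ f w Λ) ∘ conc (past₁ f w Λ)
  D₁-unfold f w ⟨ [] , _ , _ ⟩ = conc-∷-∷-++ _ _ [] []
  D₁-unfold f w Λ@(⟨ _ ∷ _ , _ , _ ⟩) = conc-∷-∷-++ _ _ (future₁ f w Λ) (past₁ f w Λ)

  D₂-unfold : ∀ f w Λ → D₂ (suc f) w Λ
    ≈ ∗ (antL Λ ↾ w) ∘ (sucL Λ ↾ w) ∘ conc (future₂ f w Λ) ∘ conc (past₂ f w Λ)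
  D₂-unfold f w ⟨ [] , _ , _ ⟩ = conc-∷-∷-++ _ _ [] []
  D₂-unfold f w Λ@(⟨ _ ∷ _ , _ , _ ⟩) = conc-∷-∷-++ _ _ (future₂ f w Λ) (past₂ f w Λ)

  ∗-D₁ : ∀ f w Λ → ∗ D₁ f w Λ ≈ D₂ f w Λ
  ∗-D₁ zero    w Λ = ∗-I
  ∗-D₁ (suc f) w Λ = begin
    ∗ D₁ (suc f) w Λ
      ≈⟨ ∗-cong (D₁-unfold f w Λ) ⟩
    ∗ ((antL Λ ↾ w) ∘ ∗ (sucL Λ ↾ w) ∘ conc (future₁ f w Λ) ∘ conc (past₁ f w Λ))
      ≈⟨ ∗-conc (_ ∷ _ ∷ _ ∷ _ ∷ []) ⟩
    ∗ (antL Λ ↾ w) ∘ ∗ ∗ (sucL Λ ↾ w) ∘ ∗ conc (future₁ f w Λ) ∘ ∗ conc (past₁ f w Λ)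
      ≈⟨ ∘-congˡ (∘-cong ∗-involutive (∘-cong futures pasts)) ⟩
    ∗ (antL Λ ↾ w) ∘ (sucL Λ ↾ w) ∘ conc (future₂ f w Λ) ∘ conc (past₂ f w Λ)
      ≈⟨ D₂-unfold f w Λ ⟨
    D₂ (suc f) w Λ ∎
    where
    D₁≈∗D₂ : ∀ u → D₁ f u (restrict w u Λ) ≈ ∗ D₂ f u (restrict w u Λ)
    D₁≈∗D₂ u = ≈-trans (≈-sym ∗-involutive) (∗-cong (∗-D₁ f u (restrict w u Λ)))
    futures : ∗ conc (future₁ f w Λ) ≈ conc (future₂ f w Λ)
    futures = ≈-trans (∗-conc-map _ (outN w (rel Λ)))
      (conc-map-cong (outN w (rel Λ)) λ {u} _ → ≈-trans ∗-involutive (•-cong (∗-D₁ f u (restrict w u Λ))))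
    pasts : ∗ conc (past₁ f w Λ) ≈ conc (past₂ f w Λ)
    pasts = ≈-trans (∗-conc-map _ (inN w (rel Λ)))
      (conc-map-cong (inN w (rel Λ)) λ {v} _ → ∗-cong (•-cong (D₁≈∗D₂ v)))

  ↾-resp-↭ : ∀ x {Γ Γ'} → Γ ↭ Γ' → Γ ↾ x ≈ Γ' ↾ x
  ↾-resp-↭ x p = conc-resp-↭ (map⁺ _ (filter-↭ _ p))

  ↾-++ : ∀ x Γ₁ Γ₂ → (Γ₁ ++ Γ₂) ↾ x ≈ (Γ₁ ↾ x) ∘ (Γ₂ ↾ x)
  ↾-++ x Γ₁ Γ₂ = begin
    (Γ₁ ++ Γ₂) ↾ x
      ≡⟨ cong (conc ∘′ map formula) (filter-++ at-x Γ₁ Γ₂) ⟩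
    conc (map formula (filter at-x Γ₁ ++ filter at-x Γ₂))
      ≡⟨ cong conc (map-++ formula (filter at-x Γ₁) (filter at-x Γ₂)) ⟩
    conc (map formula (filter at-x Γ₁) ++ map formula (filter at-x Γ₂))
      ≈⟨ conc-++ (map formula (filter at-x Γ₁)) (map formula (filter at-x Γ₂)) ⟩
    (Γ₁ ↾ x) ∘ (Γ₂ ↾ x) ∎
    where
    formula : ℕ × Fm → St
    formula lf = ⌜ proj₂ lf ⌝
    at-x : (lf : ℕ × Fm) → Dec (proj₁ lf ≡ x)
    at-x lf = proj₁ lf ≟ x

  ↾-split : ∀ x {Γ} Γ₁ Γ₂ → Γ ↭ Γ₁ ++ Γ₂ → Γ ↾ x ≈ (Γ₁ ↾ x) ∘ (Γ₂ ↾ x)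
  ↾-split x Γ₁ Γ₂ p = ≈-trans (↾-resp-↭ x p) (↾-++ x Γ₁ Γ₂)

  D₂-resp-≃ : ∀ f f' x {Λ Λ'} → length (rel Λ) < f → length (rel Λ') < f' → Λ ≃ Λ'
    → D₂ f x Λ ≈ D₂ f' x Λ'
  D₂-resp-≃ (suc f) (suc f') x {Λ} {Λ'} (s≤s bound) (s≤s bound') Λ≃Λ' = begin
    D₂ (suc f) x Λ
      ≈⟨ D₂-unfold f x Λ ⟩
    ∗ (antL Λ ↾ x) ∘ (sucL Λ ↾ x) ∘ conc (future₂ f x Λ) ∘ conc (past₂ f x Λ)
      ≈⟨ ∘-cong (∗-cong (↾-resp-↭ x (antL-↭ Λ≃Λ')))
                (∘-cong (↾-resp-↭ x (sucL-↭ Λ≃Λ')) (∘-cong futures pasts)) ⟩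
    ∗ (antL Λ' ↾ x) ∘ (sucL Λ' ↾ x) ∘ conc (future₂ f' x Λ') ∘ conc (past₂ f' x Λ')
      ≈⟨ D₂-unfold f' x Λ' ⟨
    D₂ (suc f') x Λ' ∎
    where
    subtree : ∀ {u} → Adjacent (rel Λ) x u → D₂ f u (restrict x u Λ) ≈ D₂ f' u (restrict x u Λ')
    subtree {u} adj = D₂-resp-≃ f f' u
      (<-≤-trans (restrict-shrinks x u Λ adj) bound)
      (<-≤-trans (restrict-shrinks x u Λ' (Sum.map in-Λ' in-Λ' adj)) bound')
      (restrict-resp-≃ x u Λ≃Λ')
      where
      in-Λ' : ∀ {e} → e ∈ rel Λ → e ∈ rel Λ'
      in-Λ' = ∈-resp-↭ (rel-↭ Λ≃Λ')
    futures : conc (future₂ f x Λ) ≈ conc (future₂ f' x Λ')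
    futures = conc-map-↭ (outN-↭ x (rel-↭ Λ≃Λ')) λ m → •-cong (subtree (inj₁ (outN-sound m)))
    pasts : conc (past₂ f x Λ) ≈ conc (past₂ f' x Λ')
    pasts = conc-map-↭ (inN-↭ x (rel-↭ Λ≃Λ'))
      λ m → ∗-cong (•-cong (∗-cong (subtree (inj₂ (inN-sound m)))))

  subtree-partition : ∀ {w Λ Λ₁ Λ₂ u} → Polytree Λ → Partition w Λ Λ₁ Λ₂ → Adjacent (rel Λ₁) w u
    → D₂ (length (rel Λ₁)) u (restrict w u Λ₁) ≈ D₂ (length (rel Λ)) u (restrict w u Λ)
  subtree-partition {w} {Λ} {Λ₁} {u = u} polyΛ part adj = D₂-resp-≃ _ _ u
    (restrict-shrinks w u Λ₁ adj)
    (restrict-shrinks w u Λ (Sum.map in-Λ in-Λ adj))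
    (restrict-partition polyΛ part adj)
    where
    in-Λ : ∀ {e} → e ∈ rel Λ₁ → e ∈ rel Λ
    in-Λ m = _≋_⊗_.rel-from (Partition.split part) _ (inj₁ m)

  D₂-merge : ∀ {w Λ Λ₁ Λ₂} → Polytree Λ → Partition w Λ Λ₁ Λ₂
    → 𝔇₂ w Λ₁ ∘ 𝔇₂ w Λ₂ ≈ 𝔇₂ w Λ
  D₂-merge {w} {Λ} {Λ₁} {Λ₂} polyΛ part = begin
    𝔇₂ w Λ₁ ∘ 𝔇₂ w Λ₂
      ≈⟨ ∘-cong (D₂-unfold f₁ w Λ₁) (D₂-unfold f₂ w Λ₂) ⟩
    (∗ (antL Λ₁ ↾ w) ∘ (sucL Λ₁ ↾ w) ∘ conc (future₂ f₁ w Λ₁) ∘ conc (past₂ f₁ w Λ₁))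
      ∘ (∗ (antL Λ₂ ↾ w) ∘ (sucL Λ₂ ↾ w) ∘ conc (future₂ f₂ w Λ₂) ∘ conc (past₂ f₂ w Λ₂))
      ≈⟨ ≈-trans (interchange _ _ _ _)
                 (∘-congˡ (≈-trans (interchange _ _ _ _) (∘-congˡ (interchange _ _ _ _)))) ⟩
    (∗ (antL Λ₁ ↾ w) ∘ ∗ (antL Λ₂ ↾ w)) ∘ ((sucL Λ₁ ↾ w) ∘ (sucL Λ₂ ↾ w))
      ∘ (conc (future₂ f₁ w Λ₁) ∘ conc (future₂ f₂ w Λ₂))
      ∘ (conc (past₂ f₁ w Λ₁) ∘ conc (past₂ f₂ w Λ₂))
      ≈⟨ ∘-cong antecedents (∘-cong succedents (∘-cong futures pasts)) ⟩
    ∗ (antL Λ ↾ w) ∘ (sucL Λ ↾ w) ∘ conc (future₂ f w Λ) ∘ conc (past₂ f w Λ)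
      ≈⟨ D₂-unfold f w Λ ⟨
    𝔇₂ w Λ ∎
    where
    open Partition part
    open _≋_⊗_ split
    f f₁ f₂ : ℕ
    f  = length (rel Λ)
    f₁ = length (rel Λ₁)
    f₂ = length (rel Λ₂)
    part' : Partition w Λ Λ₂ Λ₁
    part' = Partition-swap part
    antecedents : ∗ (antL Λ₁ ↾ w) ∘ ∗ (antL Λ₂ ↾ w) ≈ ∗ (antL Λ ↾ w)
    antecedents = ≈-sym (≈-trans (∗-cong (↾-split w (antL Λ₁) (antL Λ₂) ant-eq)) ∗-distrib-∘)
    succedents : (sucL Λ₁ ↾ w) ∘ (sucL Λ₂ ↾ w) ≈ sucL Λ ↾ w
    succedents = ≈-sym (↾-split w (sucL Λ₁) (sucL Λ₂) suc-eq)
    futures : conc (future₂ f₁ w Λ₁) ∘ conc (future₂ f₂ w Λ₂) ≈ conc (future₂ f w Λ)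
    futures = conc-map-split (outN-split w (rel Λ₁) (rel Λ₂) (partition-rel-↭ polyΛ part))
      (λ m → •-cong (subtree-partition polyΛ part (inj₁ (outN-sound m))))
      (λ m → •-cong (subtree-partition polyΛ part' (inj₁ (outN-sound m))))
    pasts : conc (past₂ f₁ w Λ₁) ∘ conc (past₂ f₂ w Λ₂) ≈ conc (past₂ f w Λ)
    pasts = conc-map-split (inN-split w (rel Λ₁) (rel Λ₂) (partition-rel-↭ polyΛ part))
      (λ m → ∗-cong (•-cong (∗-cong (subtree-partition polyΛ part (inj₂ (inN-sound m))))))
      (λ m → ∗-cong (•-cong (∗-cong (subtree-partition polyΛ part' (inj₂ (inN-sound m))))))

  partition-sequent⟺ : ∀ {w Λ Λ₁ Λ₂} → Polytree Λ → Partition w Λ Λ₁ Λ₂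
    → (𝔇₁ w Λ₁ ⊢ 𝔇₂ w Λ₂) ⟺ (I ⊢ 𝔇₂ w Λ)
  partition-sequent⟺ {w} {Λ} {Λ₁} {Λ₂} polyΛ part = ⟺-trans ⊢⟺I⊢∗∘ (succedent (begin
    ∗ 𝔇₁ w Λ₁ ∘ 𝔇₂ w Λ₂   ≈⟨ ∘-congʳ (∗-D₁ (suc (length (rel Λ₁))) w Λ₁) ⟩
    𝔇₂ w Λ₁ ∘ 𝔇₂ w Λ₂     ≈⟨ D₂-merge polyΛ part ⟩
    𝔇₂ w Λ                ∎))

lemma5 : (𝒫 : List Axiom) (Λ : LSeq) (w : ℕ) → Polytree Λ → w ∈Lab Λ
    → (Λ₁ Λ₂ Λ₁' Λ₂' : LSeq) → Partition w Λ Λ₁ Λ₂ → Partition w Λ Λ₁' Λ₂'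
    → Der 𝒫 (𝔇₁ w Λ₁ ⊢ 𝔇₂ w Λ₂) (𝔇₁ w Λ₁' ⊢ 𝔇₂ w Λ₂')
      × Der 𝒫 (𝔇₁ w Λ₁' ⊢ 𝔇₂ w Λ₂') (𝔇₁ w Λ₁ ⊢ 𝔇₂ w Λ₂)
lemma5 𝒫 Λ w polyΛ _ Λ₁ Λ₂ Λ₁' Λ₂' part part' = to both hyp , from both hyp
  where
  open DisplayEquivalence 𝒫
  open Translations 𝒫
  both : (𝔇₁ w Λ₁ ⊢ 𝔇₂ w Λ₂) ⟺ (𝔇₁ w Λ₁' ⊢ 𝔇₂ w Λ₂')
  both = ⟺-trans (partition-sequent⟺ polyΛ part) (⟺-sym (partition-sequent⟺ polyΛ part'))
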